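{- Let $A,B,C$ be pairwise coprime integers greater than $1$, and let $(X,Y,Z)$ be a solution in positive integers of $A^X-B^Y=C^Z$. Put $G=\gcd(X,Y)$. If $G>1$, then \[X<\frac{G}{G-1}\frac{\log C}{\log A}Z,\qquad Y<\frac{G}{G-1}\frac{\log C}{\log B}Z.\] -}

module Defs where

{-# OPTIONS --safe #-}
module Submission where

-- Let G be a common divisor of X and Y, G = 1 + n with n ≥ 1, and put a = A^(X/G),
-- b = B^(Y/G), c = C^Z, so that a^(1+n) = b^(1+n) + c. Then b < a, hence
-- (1 + b)·a^n ≤ a^(1+n) = b·b^n + c < b·a^n + c, i.e. a^n < c and a fortiori b^n < c.
-- Raising both to the G-th power gives A^(nX) < C^(GZ) and B^(nY) < C^(GZ).

open import Defs
open import Data.Nat using (ℕ; _+_; _*_; _∸_; _^_; _<_; suc; z<s; s<s; NonZero; >-nonZero)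
open import Data.Nat.GCD using (gcd; gcd[m,n]∣m; gcd[m,n]∣n)
open import Data.Nat.Coprimality using (Coprime)
open import Data.Nat.Divisibility using (_∣_; divides)
open import Data.Nat.Properties
open import Data.Product using (_×_; _,_)
open import Relation.Binary.PropositionalEquality using (_≡_; refl; sym; trans; cong; subst; subst₂; module ≡-Reasoning)
open import Relation.Nullary using (contraposition)

^-cancelˡ-< : ∀ n {m o} → m ^ n < o ^ n → m < o
^-cancelˡ-< n m^n<o^n = ≰⇒> (contraposition (^-monoˡ-≤ n) (<⇒≱ m^n<o^n))

m^n≡o^n+p⇒o<m : ∀ {m o p} n → 0 < p → m ^ n ≡ o ^ n + p → o < m
m^n≡o^n+p⇒o<m {o = o} n 0<p eq = ^-cancelˡ-< n (subst (o ^ n <_) (sym eq) (m<m+n (o ^ n) 0<p))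

m^1+n≡o^1+n+p⇒m^n<p : ∀ n .{{_ : NonZero n}} {m o p} → 0 < o → 0 < p
                    → m ^ suc n ≡ o ^ suc n + p → m ^ n < p
m^1+n≡o^1+n+p⇒m^n<p n {m} {o} {p} 0<o 0<p eq = +-cancelˡ-< (o * m ^ n) (m ^ n) p (begin-strict
  o * m ^ n + m ^ n ≡⟨ +-comm (o * m ^ n) (m ^ n) ⟩
  suc o * m ^ n     ≤⟨ *-monoˡ-≤ (m ^ n) (m^n≡o^n+p⇒o<m {m} {o} (suc n) 0<p eq) ⟩
  m ^ suc n         ≡⟨ eq ⟩
  o * o ^ n + p     <⟨ +-monoˡ-< p (*-monoʳ-< o {{>-nonZero 0<o}} o^n<m^n) ⟩
  o * m ^ n + p     ∎)
  where
  open ≤-Reasoning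
  o^n<m^n : o ^ n < m ^ n
  o^n<m^n = ^-monoˡ-< n (m^n≡o^n+p⇒o<m {m} {o} (suc n) 0<p eq)

m^[k*[x*g]]≡[[m^x]^k]^g : ∀ m x k g → m ^ (k * (x * g)) ≡ ((m ^ x) ^ k) ^ g
m^[k*[x*g]]≡[[m^x]^k]^g m x k g = begin
  m ^ (k * (x * g))   ≡⟨ cong (m ^_) (sym (*-assoc k x g)) ⟩
  m ^ (k * x * g)     ≡⟨ cong (λ e → m ^ (e * g)) (*-comm k x) ⟩
  m ^ (x * k * g)     ≡⟨ sym (^-*-assoc m (x * k) g) ⟩
  (m ^ (x * k)) ^ g   ≡⟨ cong (_^ g) (sym (^-*-assoc m x k)) ⟩
  ((m ^ x) ^ k) ^ g   ∎
  where open ≡-Reasoning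

common-divisor-bounds : ∀ {A B C X Y Z G} → 0 < B → 0 < C → G ∣ X → G ∣ Y → 1 < G
                      → A ^ X ≡ B ^ Y + C ^ Z
                      → (A ^ ((G ∸ 1) * X) < C ^ (G * Z)) × (B ^ ((G ∸ 1) * Y) < C ^ (G * Z))
common-divisor-bounds {A} {B@(suc _)} {C@(suc _)} {Z = Z} {suc n} _ _
                      (divides x refl) (divides y refl) (s<s 0<n) eq
  = raise A x a^n<c , raise B y b^n<c
  where
  instance _ = >-nonZero 0<n
  G = suc n
  eqᴳ : (A ^ x) ^ G ≡ (B ^ y) ^ G + C ^ Z
  eqᴳ = begin
    (A ^ x) ^ G           ≡⟨ ^-*-assoc A x G ⟩
    A ^ (x * G)           ≡⟨ eq ⟩
    B ^ (y * G) + C ^ Z   ≡⟨ cong (_+ C ^ Z) (sym (^-*-assoc B y G)) ⟩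
    (B ^ y) ^ G + C ^ Z   ∎
    where open ≡-Reasoning
  a^n<c : (A ^ x) ^ n < C ^ Z
  a^n<c = m^1+n≡o^1+n+p⇒m^n<p n (m^n>0 B y) (m^n>0 C Z) eqᴳ
  b^n<c : (B ^ y) ^ n < C ^ Z
  b^n<c = ≤-<-trans (^-monoˡ-≤ n (<⇒≤ (m^n≡o^n+p⇒o<m {A ^ x} G (m^n>0 C Z) eqᴳ))) a^n<c
  raise : ∀ M m → (M ^ m) ^ n < C ^ Z → M ^ (n * (m * G)) < C ^ (G * Z)
  raise M m lt = subst₂ _<_ (sym (m^[k*[x*g]]≡[[m^x]^k]^g M m n G))
                            (trans (^-*-assoc C Z G) (cong (C ^_) (*-comm Z G)))
                            (^-monoˡ-< G lt)

lemma6p5 : (A B C X Y Z : ℕ) → 1 < A → 1 < B → 1 < C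
    → Coprime A B → Coprime B C → Coprime A C
    → 0 < X → 0 < Y → 0 < Z
    → A ^ X ≡ B ^ Y + C ^ Z
    → 1 < gcd X Y
    → (A ^ ((gcd X Y ∸ 1) * X) < C ^ (gcd X Y * Z))
      × (B ^ ((gcd X Y ∸ 1) * Y) < C ^ (gcd X Y * Z))
lemma6p5 A B C X Y Z _ 1<B 1<C _ _ _ _ _ _ eq 1<G =
  common-divisor-bounds (<-trans z<s 1<B) (<-trans z<s 1<C)
                        (gcd[m,n]∣m X Y) (gcd[m,n]∣n X Y) 1<G eq
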